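{- Let $G$ be a complete $k$-partite graph of order $n$ with partite sets $X_1,\dots,X_k$, where $k\ge 2$, and let $T_0\in\mathcal{P}_b(G)$ with $1\le b\le n$. Then $|E(G[T_0])|\ge|E(G[T])|$ for every $T\in\mathcal{P}_b(G)$ if and only if for every pair of distinct $i,j\in\{1,\dots,k\}$, $|X_i\cap T_0|\ge|X_j\cap T_0|+2$ implies $X_j\subseteq T_0$.
   Context: $\mathcal{P}_b(G)$ is the family of $b$-element subsets of $V(G)$; $G[U]$ is the subgraph induced by $U$. -}

module Defs where

open import Data.Nat using (ℕ; _<_; _<?_)
open import Data.Bool using (Bool; true; false; _∧_)
open import Data.Fin using (Fin; toℕ; _≟_)
open import Data.Fin.Subset using (Subset; inside; _∈_)
open import Data.Fin.Subset.Properties using (_∈?_)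
open import Data.Vec using (tabulate)
open import Data.List using (List; length; filter; allFin; cartesianProduct)
open import Data.Product using (_×_; _,_; ∃)
open import Relation.Binary.PropositionalEquality using (_≡_; _≢_)
open import Relation.Nullary using (¬_; Dec)
open import Relation.Nullary.Decidable using (⌊_⌋; _×-dec_)
open import Function.Bundles using (_⇔_)

record SimpleGraph (n : ℕ) : Set where
  field
    adj   : Fin n → Fin n → Bool
    sym   : ∀ u v → adj u v ≡ adj v u
    irrefl : ∀ v → adj v v ≡ false
open SimpleGraph public

-- G is a complete k-partite graph whose partite sets are the fibres of
-- part : Fin n → Fin k (each partite set nonempty, i.e. part is
-- surjective); two vertices are adjacent iff they lie in different parts.
record IsCompleteMultipartite {n : ℕ} (G : SimpleGraph n) (k : ℕ)
                              (part : Fin n → Fin k) : Set where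
  field
    nonempty : ∀ (i : Fin k) → ∃ λ v → part v ≡ i
    adj-iff  : ∀ u v → (adj G u v ≡ true) ⇔ (part u ≢ part v)

partSet : ∀ {n k} → (Fin n → Fin k) → Fin k → Subset n
partSet part i = tabulate (λ v → ⌊ part v ≟ i ⌋)

edgesIn : ∀ {n} → SimpleGraph n → Subset n → ℕ
edgesIn {n} G T = length (filter ok (cartesianProduct (allFin n) (allFin n)))
  where
  Ok : Fin n × Fin n → Set
  Ok (u , v) = ((toℕ u < toℕ v × u ∈ T) × v ∈ T) × adj G u v ≡ true
  ok : (p : Fin n × Fin n) → Dec (Ok p)
  ok (u , v) = (((toℕ u <? toℕ v) ×-dec (u ∈? T)) ×-dec (v ∈? T)) ×-dec (adj G u v Data.Bool.≟ true)

-- Adding a vertex v to a set s of vertices of a complete multipartite graph creates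
-- |s| − |X(v) ∩ s| new edges, X(v) being the partite set of v.  Hence exchanging
-- u ∈ T for v ∉ T changes |E(G[T])| by |X(u) ∩ S| − |X(v) ∩ S|, where S = T − u.
-- If T₀ is optimal but |X_i ∩ T₀| ≥ |X_j ∩ T₀| + 2 with some w ∈ X_j − T₀, exchanging
-- a vertex of X_i ∩ T₀ for w gains an edge.  Conversely, if T₀ satisfies the
-- condition, every T with |T| = |T₀| is carried to T₀ by exchanges u ∈ T − T₀,
-- v ∈ T₀ − T that never lose an edge: within one partite set when one of the two
-- classes allows it, and otherwise the condition on T₀ keeps the classes of u and v
-- close enough; induction on |T − T₀| ends with T ⊆ T₀.
module Submission where

open import Data.Bool using (Bool; true; false; _∧_; not)
import Data.Bool as 𝔹
import Data.Bool.Properties as 𝔹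
open import Data.Bool.Properties using (∧-comm; ∧-assoc; ∧-zeroʳ; ∧-identityʳ)
open import Data.Fin using (Fin; zero; suc; toℕ; punchIn) renaming (_≟_ to _≟ᶠ_)
open import Data.Fin.Properties using (punchInᵢ≢i; toℕ-injective)
open import Data.Fin.Subset using (Subset; inside; outside; ∣_∣; _∩_; _⊆_)
open import Data.Fin.Subset.Properties using (_∈?_)
open import Data.List using (length; filter; cartesianProduct; map; _++_)
import Data.List as List
open import Data.List.Properties using (filter-++; length-++; map-tabulate)
open import Data.Nat using (ℕ; zero; suc; _+_; _≤_; _<_; z≤n; z<s; _<?_; _≤?_)
open import Data.Nat.Properties
open import Algebra.Properties.CommutativeMonoid.Sum +-0-commutativeMonoid
  using (sum; sum-remove; sum-cong-≗; sum-replicate-zero; ∑-distrib-+)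
open import Data.Nat.Tactic.RingSolver using (solve-∀)
open import Data.Product using (_×_; _,_; ∃; proj₁; proj₂)
open import Data.Vec using ([]; _∷_; lookup; _[_]≔_)
open import Data.Vec.Properties
  using (lookup∘update; lookup∘update′; lookup∘tabulate; lookup-zipWith; []=⇒lookup; lookup⇒[]=)
open import Function using (_∘_; id)
open import Function.Bundles using (_⇔_; mk⇔; Equivalence)
open import Relation.Binary using (tri<; tri≈; tri>)
open import Relation.Binary.PropositionalEquality
open import Relation.Nullary using (¬_; yes; no; does; contradiction)
open import Relation.Nullary.Decidable using (dec-true; dec-false; isYes≗does)
open import Relation.Unary using (Pred; Decidable)

open import Defs hiding (sym)

𝟙 : Bool → ℕ
𝟙 true  = 1
𝟙 false = 0

count : ∀ {n} → (Fin n → Bool) → ℕ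
count p = sum (𝟙 ∘ p)

≤-sum : ∀ {n} (f : Fin n → ℕ) i → f i ≤ sum f
≤-sum {suc _} f i = ≤-trans (m≤m+n (f i) _) (≤-reflexive (sym (sum-remove f)))

sum-mono-≤ : ∀ {n} {f g : Fin n → ℕ} → (∀ i → f i ≤ g i) → sum f ≤ sum g
sum-mono-≤ {zero}  f≤g = z≤n
sum-mono-≤ {suc n} f≤g = +-mono-≤ (f≤g zero) (sum-mono-≤ (f≤g ∘ suc))

sum-update : ∀ {n} (f g : Fin n → ℕ) u → (∀ i → i ≢ u → g i ≡ f i) →
             sum g + f u ≡ sum f + g u
sum-update {suc n} f g u g≡f = begin
  sum g + f u                      ≡⟨ cong (_+ f u) (sum-remove g) ⟩
  g u + sum (g ∘ punchIn u) + f u  ≡⟨ cong (λ r → g u + r + f u) rest ⟩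
  g u + sum (f ∘ punchIn u) + f u  ≡⟨ swap (g u) (sum (f ∘ punchIn u)) (f u) ⟩
  f u + sum (f ∘ punchIn u) + g u  ≡⟨ cong (_+ g u) (sym (sum-remove f)) ⟩
  sum f + g u                      ∎
  where
  open ≡-Reasoning
  rest : sum (g ∘ punchIn u) ≡ sum (f ∘ punchIn u)
  rest = sum-cong-≗ (λ i → g≡f (punchIn u i) (punchInᵢ≢i u i))
  swap : ∀ a r b → a + r + b ≡ b + r + a
  swap = solve-∀

sum≡0⇒≡0 : ∀ {n} (f : Fin n → ℕ) → sum f ≡ 0 → ∀ i → f i ≡ 0
sum≡0⇒≡0 f Σf≡0 i = n≤0⇒n≡0 (subst (f i ≤_) Σf≡0 (≤-sum f i))

count≡0⇒≡false : ∀ {n} (p : Fin n → Bool) → count p ≡ 0 → ∀ x → p x ≡ false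
count≡0⇒≡false p #p≡0 x with p x | sum≡0⇒≡0 (𝟙 ∘ p) #p≡0 x
... | false | _ = refl

count-witness : ∀ {n} (p : Fin n → Bool) → 0 < count p → ∃ λ x → p x ≡ true
count-witness {suc n} p 0<#p with p zero in p0
... | true  = zero , p0
... | false with count-witness (p ∘ suc) 0<#p
...   | x , px = suc x , px

𝟙-not+𝟙 : ∀ l b → 𝟙 (not l ∧ b) + 𝟙 (l ∧ b) ≡ 𝟙 b
𝟙-not+𝟙 false b = +-identityʳ (𝟙 b)
𝟙-not+𝟙 true  b = refl

count-not+count : ∀ {n} (c p : Fin n → Bool) →
  count (λ x → not (c x) ∧ p x) + count (λ x → c x ∧ p x) ≡ count p
count-not+count c p =
  trans (sym (∑-distrib-+ (λ x → 𝟙 (not (c x) ∧ p x)) (λ x → 𝟙 (c x ∧ p x))))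
        (sum-cong-≗ (λ x → 𝟙-not+𝟙 (c x) (p x)))

𝟙-mono : ∀ {a b} → a 𝔹.≤ b → 𝟙 a ≤ 𝟙 b
𝟙-mono 𝔹.f≤t = z≤n
𝟙-mono 𝔹.b≤b = ≤-refl

∧-mono : ∀ {a a′ b b′} → a 𝔹.≤ a′ → b 𝔹.≤ b′ → a ∧ b 𝔹.≤ a′ ∧ b′
∧-mono 𝔹.f≤t _ = 𝔹.≤-minimum _
∧-mono {true}  𝔹.b≤b b≤b′ = b≤b′
∧-mono {false} 𝔹.b≤b _    = 𝔹.b≤b

∧≡true : ∀ {a b} → a ∧ b ≡ true → a ≡ true × b ≡ true
∧≡true {true}  {true}  _ = refl , refl
∧≡true {true}  {false} ()
∧≡true {false}         ()

not∧≡true : ∀ {a b} → not a ∧ b ≡ true → a ≡ false × b ≡ true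
not∧≡true {false} {true}  _ = refl , refl
not∧≡true {false} {false} ()
not∧≡true {true}          ()

not∧≡false⇒≤ : ∀ {a b} → not a ∧ b ≡ false → b 𝔹.≤ a
not∧≡false⇒≤ {true}  {false} _ = 𝔹.f≤t
not∧≡false⇒≤ {true}  {true}  _ = 𝔹.b≤b
not∧≡false⇒≤ {false} {false} _ = 𝔹.b≤b

∧-reorder : ∀ l p q a → ((l ∧ p) ∧ q) ∧ a ≡ (p ∧ (l ∧ a)) ∧ q
∧-reorder false p     q a = sym (cong (_∧ q) (∧-zeroʳ p))
∧-reorder true  false q a = refl
∧-reorder true  true  q a = ∧-comm q a

does-≟⇒≡ : ∀ {k} {i j : Fin k} → does (i ≟ᶠ j) ≡ true → i ≡ j
does-≟⇒≡ {i = i} {j} _ with i ≟ᶠ j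
... | yes i≡j = i≡j

exchange-partner : ∀ {n} (a b : Fin n → Bool) → count a ≤ count b →
  ∀ {x} → a x ≡ true → b x ≡ false → ∃ λ y → b y ≡ true × a y ≡ false
exchange-partner a b #a≤#b {x} ax bx with count-witness (λ y → not (a y) ∧ b y) 0<#b∖a
  where
  0<#a∖b : 0 < count (λ y → not (b y) ∧ a y)
  0<#a∖b = <-≤-trans (subst (λ c → 0 < 𝟙 c) (sym (cong₂ (λ p q → not p ∧ q) bx ax)) z<s)
                     (≤-sum (λ y → 𝟙 (not (b y) ∧ a y)) x)
  0<#b∖a : 0 < count (λ y → not (a y) ∧ b y)
  0<#b∖a = <-≤-trans 0<#a∖b (+-cancelʳ-≤ _ _ _ (begin
    count (λ y → not (b y) ∧ a y) + count (λ y → a y ∧ b y)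
      ≡⟨ cong (count (λ y → not (b y) ∧ a y) +_) (sum-cong-≗ λ y → cong 𝟙 (∧-comm (a y) (b y))) ⟩
    count (λ y → not (b y) ∧ a y) + count (λ y → b y ∧ a y)  ≡⟨ count-not+count b a ⟩
    count a                                                  ≤⟨ #a≤#b ⟩
    count b                                                  ≡⟨ sym (count-not+count a b) ⟩
    count (λ y → not (a y) ∧ b y) + count (λ y → a y ∧ b y)  ∎))
    where open ≤-Reasoning
... | y , b∖a = y , proj₂ (not∧≡true b∖a) , proj₁ (not∧≡true b∖a)

exchange-partner-within : ∀ {n} (c a b : Fin n → Bool) →
  count (λ x → c x ∧ a x) ≤ count (λ x → c x ∧ b x) →
  ∀ {x} → c x ≡ true → a x ≡ true → b x ≡ false →
  ∃ λ y → c y ≡ true × b y ≡ true × a y ≡ false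
exchange-partner-within c a b #ca≤#cb cx ax bx
  with exchange-partner (λ y → c y ∧ a y) (λ y → c y ∧ b y) #ca≤#cb
                        (cong₂ _∧_ cx ax) (cong₂ _∧_ cx bx)
... | y , cy∧by , cy∧ay≡false with ∧≡true cy∧by
...   | cy , by = y , cy , by , subst (λ b → b ∧ a y ≡ false) cy cy∧ay≡false

record Insertion {n} (s : Fin n → Bool) (u : Fin n) (t : Fin n → Bool) : Set where
  field
    fresh     : s u ≡ false
    added     : t u ≡ true
    elsewhere : ∀ x → x ≢ u → t x ≡ s x

count-insertion : ∀ {n} {s t : Fin n → Bool} {u} → Insertion s u t → (c : Fin n → Bool) →
  count (λ x → c x ∧ t x) ≡ 𝟙 (c u) + count (λ x → c x ∧ s x)
count-insertion {s = s} {t} {u} ins c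
  with sum-update (λ x → 𝟙 (c x ∧ s x)) (λ x → 𝟙 (c x ∧ t x)) u
         (λ x x≢u → cong (λ b → 𝟙 (c x ∧ b)) (Insertion.elsewhere ins x x≢u))
... | updated rewrite Insertion.fresh ins | Insertion.added ins | ∧-zeroʳ (c u) | ∧-identityʳ (c u) =
  trans (sym (+-identityʳ _)) (trans updated (+-comm _ (𝟙 (c u))))

exchange : ∀ {n} → Subset n → Fin n → Fin n → Subset n
exchange T u v = (T [ u ]≔ outside) [ v ]≔ inside

module _ {n} (T : Subset n) (u v : Fin n) (u∈T : lookup T u ≡ true) (v∉T : lookup T v ≡ false) where

  removal-insertion : Insertion (lookup (T [ u ]≔ outside)) u (lookup T)
  removal-insertion = record
    { fresh     = lookup∘update u T outside
    ; added     = u∈T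
    ; elsewhere = λ x x≢u → sym (lookup∘update′ x≢u T outside)
    }

  exchange-insertion : Insertion (lookup (T [ u ]≔ outside)) v (lookup (exchange T u v))
  exchange-insertion = record
    { fresh     = trans (lookup∘update′ v≢u T outside) v∉T
    ; added     = lookup∘update v (T [ u ]≔ outside) inside
    ; elsewhere = λ x x≢v → lookup∘update′ x≢v (T [ u ]≔ outside) inside
    }
    where
    v≢u : v ≢ u
    v≢u refl = contradiction (trans (sym u∈T) v∉T) λ ()

  count-exchange : count (lookup (exchange T u v)) ≡ count (lookup T)
  count-exchange = trans (count-insertion exchange-insertion (λ _ → true))
                         (sym (count-insertion removal-insertion (λ _ → true)))

≤-by-balance : ∀ {a b c d} → a + b ≡ c + d → d ≤ b → a ≤ c
≤-by-balance {a} {b} {c} {d} eq d≤b =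
  +-cancelʳ-≤ d a c (≤-trans (+-monoʳ-≤ a d≤b) (≤-reflexive eq))

<-by-balance : ∀ {a b c d} → a + b ≡ c + d → d < b → a < c
<-by-balance {a} {b} {c} {d} eq d<b =
  +-cancelʳ-< d a c (<-≤-trans (+-monoʳ-< a d<b) (≤-reflexive eq))

_<ᵇ_ : ∀ {n} → Fin n → Fin n → Bool
x <ᵇ y = does (toℕ x <? toℕ y)

<ᵇ-irrefl : ∀ {n} (x : Fin n) → x <ᵇ x ≡ false
<ᵇ-irrefl x = dec-false (toℕ x <? toℕ x) (<-irrefl refl)

<ᵇ-flip : ∀ {n} {x y : Fin n} → x ≢ y → x <ᵇ y ≡ not (y <ᵇ x)
<ᵇ-flip {x = x} {y} x≢y with <-cmp (toℕ x) (toℕ y)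
... | tri< x<y _ _ = trans (dec-true (toℕ x <? toℕ y) x<y)
                           (cong not (sym (dec-false (toℕ y <? toℕ x) (<-asym x<y))))
... | tri≈ _ x≡y _ = contradiction (toℕ-injective x≡y) x≢y
... | tri> _ _ y<x = trans (dec-false (toℕ x <? toℕ y) (<-asym y<x))
                           (cong not (sym (dec-true (toℕ y <? toℕ x) y<x)))

module _ {n} (G : SimpleGraph n) where

  edgeCount : (Fin n → Bool) → ℕ
  edgeCount t = sum λ x → sum λ y → 𝟙 (((x <ᵇ y ∧ t x) ∧ t y) ∧ adj G x y)

  degree : (Fin n → Bool) → Fin n → ℕ
  degree t v = count (λ y → adj G v y ∧ t y)

  edgeCount-mono : ∀ {s t} → (∀ x → s x 𝔹.≤ t x) → edgeCount s ≤ edgeCount t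
  edgeCount-mono s≤t = sum-mono-≤ λ x → sum-mono-≤ λ y →
    𝟙-mono (∧-mono (∧-mono (∧-mono (𝔹.≤-refl {x <ᵇ y}) (s≤t x)) (s≤t y)) (𝔹.≤-refl {adj G x y}))

  private
    forward : Fin n → Fin n → Bool
    forward x y = x <ᵇ y ∧ adj G x y

    -- x is read in r and y in t, so that the two memberships can be changed one at a time.
    row : (Fin n → Bool) → (Fin n → Bool) → Fin n → ℕ
    row r t x = count (λ y → (r x ∧ forward x y) ∧ t y)

    earlier later : (Fin n → Bool) → Fin n → ℕ
    earlier t v = count (λ x → forward x v ∧ t x)
    later   t v = count (λ y → forward v y ∧ t y)

    edgeCount-rows : ∀ t → edgeCount t ≡ sum (row t t)
    edgeCount-rows t = sum-cong-≗ λ x → sum-cong-≗ λ y →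
      cong 𝟙 (∧-reorder (x <ᵇ y) (t x) (t y) (adj G x y))

    earlier+later≡degree : ∀ t v → earlier t v + later t v ≡ degree t v
    earlier+later≡degree t v =
      trans (sym (∑-distrib-+ (λ x → 𝟙 (forward x v ∧ t x)) (λ y → 𝟙 (forward v y ∧ t y))))
            (sum-cong-≗ split)
      where
      split : ∀ y → 𝟙 (forward y v ∧ t y) + 𝟙 (forward v y ∧ t y) ≡ 𝟙 (adj G v y ∧ t y)
      split y with y ≟ᶠ v
      ... | yes refl rewrite <ᵇ-irrefl y | SimpleGraph.irrefl G y = refl
      ... | no y≢v rewrite <ᵇ-flip y≢v | SimpleGraph.sym G y v
                         | ∧-assoc (not (v <ᵇ y)) (adj G v y) (t y) | ∧-assoc (v <ᵇ y) (adj G v y) (t y) =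
        𝟙-not+𝟙 (v <ᵇ y) (adj G v y ∧ t y)

  -- Summing by rows: inserting v adds the entry (x , v) to each row x and creates the row of v.
  edgeCount-insertion : ∀ {s t v} → Insertion s v t → edgeCount t ≡ edgeCount s + degree s v
  edgeCount-insertion {s} {t} {v} ins = begin
    edgeCount t
      ≡⟨ edgeCount-rows t ⟩
    sum (row t t)
      ≡⟨ sum-cong-≗ (λ x → count-insertion ins (λ y → t x ∧ forward x y)) ⟩
    sum (λ x → 𝟙 (t x ∧ forward x v) + row t s x)
      ≡⟨ ∑-distrib-+ (λ x → 𝟙 (t x ∧ forward x v)) (row t s) ⟩
    sum (λ x → 𝟙 (t x ∧ forward x v)) + sum (row t s)
      ≡⟨ cong₂ _+_ column-v rows-with-v ⟩
    earlier s v + (edgeCount s + later s v)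
      ≡⟨ rearrange (earlier s v) (edgeCount s) (later s v) ⟩
    edgeCount s + (earlier s v + later s v)
      ≡⟨ cong (edgeCount s +_) (earlier+later≡degree s v) ⟩
    edgeCount s + degree s v
      ∎
    where
    open ≡-Reasoning
    open Insertion ins
    rearrange : ∀ a e b → a + (e + b) ≡ e + (a + b)
    rearrange = solve-∀
    column-v : sum (λ x → 𝟙 (t x ∧ forward x v)) ≡ earlier s v
    column-v = begin
      sum (λ x → 𝟙 (t x ∧ forward x v))
        ≡⟨ sum-cong-≗ (λ x → cong 𝟙 (∧-comm (t x) (forward x v))) ⟩
      earlier t v
        ≡⟨ count-insertion ins (λ x → forward x v) ⟩
      𝟙 (forward v v) + earlier s v
        ≡⟨ cong (λ b → 𝟙 (b ∧ adj G v v) + earlier s v) (<ᵇ-irrefl v) ⟩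
      earlier s v
        ∎
    row-of : ∀ {x} → t x ≡ s x → row t s x ≡ row s s x
    row-of {x} tx≡sx = cong (λ b → count (λ y → (b ∧ forward x y) ∧ s y)) tx≡sx
    rows-with-v : sum (row t s) ≡ edgeCount s + later s v
    rows-with-v = begin
      sum (row t s)
        ≡⟨ sym (+-identityʳ _) ⟩
      sum (row t s) + 0
        ≡⟨ cong (sum (row t s) +_) (sym empty-row) ⟩
      sum (row t s) + row s s v
        ≡⟨ sum-update (row s s) (row t s) v (λ x x≢v → row-of (elsewhere x x≢v)) ⟩
      sum (row s s) + row t s v
        ≡⟨ cong₂ _+_ (sym (edgeCount-rows s)) (cong (λ b → count (λ y → (b ∧ forward v y) ∧ s y)) added) ⟩
      edgeCount s + later s v
        ∎
      where
      empty-row : row s s v ≡ 0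
      empty-row = trans (cong (λ b → count (λ y → (b ∧ forward v y) ∧ s y)) fresh) (sum-replicate-zero n)

partCount : ∀ {n k} → (Fin n → Fin k) → Fin k → (Fin n → Bool) → ℕ
partCount part j t = count (λ x → does (part x ≟ᶠ j) ∧ t x)

module _ {n k} (part : Fin n → Fin k) {s t : Fin n → Bool} {u : Fin n} (ins : Insertion s u t) where

  partCount-insertion-own : ∀ {j} → part u ≡ j → partCount part j t ≡ suc (partCount part j s)
  partCount-insertion-own {j} pu≡j =
    trans (count-insertion ins (λ x → does (part x ≟ᶠ j)))
          (cong (λ b → 𝟙 b + partCount part j s) (dec-true (part u ≟ᶠ j) pu≡j))

  partCount-insertion-other : ∀ {j} → part u ≢ j → partCount part j t ≡ partCount part j s
  partCount-insertion-other {j} pu≢j =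
    trans (count-insertion ins (λ x → does (part x ≟ᶠ j)))
          (cong (λ b → 𝟙 b + partCount part j s) (dec-false (part u ≟ᶠ j) pu≢j))

module _ {n k} {G : SimpleGraph n} {part : Fin n → Fin k} (M : IsCompleteMultipartite G k part) where

  open IsCompleteMultipartite M using (adj-iff)

  adj≡different : ∀ x y → adj G x y ≡ not (does (part y ≟ᶠ part x))
  adj≡different x y with part y ≟ᶠ part x | adj G x y in xy
  ... | yes py≡px | true  = contradiction (sym py≡px) (Equivalence.to (adj-iff x y) xy)
  ... | yes _     | false = refl
  ... | no _      | true  = refl
  ... | no py≢px  | false with trans (sym xy) (Equivalence.from (adj-iff x y) (py≢px ∘ sym))
  ...   | ()

  degree+partCount≡count : ∀ t v → degree G t v + partCount part (part v) t ≡ count t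
  degree+partCount≡count t v = trans
    (cong (_+ partCount part (part v) t) (sum-cong-≗ λ y → cong (λ b → 𝟙 (b ∧ t y)) (adj≡different v y)))
    (count-not+count (λ y → does (part y ≟ᶠ part v)) t)

  edgeCount-insertion-multipartite : ∀ {s t v} → Insertion s v t →
    edgeCount G t + partCount part (part v) s ≡ edgeCount G s + count s
  edgeCount-insertion-multipartite {s} {t} {v} ins = begin
    edgeCount G t + partCount part (part v) s
      ≡⟨ cong (_+ partCount part (part v) s) (edgeCount-insertion G ins) ⟩
    edgeCount G s + degree G s v + partCount part (part v) s
      ≡⟨ +-assoc (edgeCount G s) _ _ ⟩
    edgeCount G s + (degree G s v + partCount part (part v) s)
      ≡⟨ cong (edgeCount G s +_) (degree+partCount≡count s v) ⟩
    edgeCount G s + count s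
      ∎
    where open ≡-Reasoning

  edgeCount-exchange : ∀ {s t t′ u v} → Insertion s u t → Insertion s v t′ →
    edgeCount G t + partCount part (part u) s ≡ edgeCount G t′ + partCount part (part v) s
  edgeCount-exchange ins-u ins-v =
    trans (edgeCount-insertion-multipartite ins-u) (sym (edgeCount-insertion-multipartite ins-v))

module _ {n k} {G : SimpleGraph n} {part : Fin n → Fin k} (M : IsCompleteMultipartite G k part)
         (T₀ : Subset n) where

  private
    t₀ : Fin n → Bool
    t₀ = lookup T₀

    inPart : Fin k → Fin n → Bool
    inPart j x = does (part x ≟ᶠ j)

  Optimal : Set
  Optimal = ∀ (T : Subset n) → count (lookup T) ≡ count t₀ → edgeCount G (lookup T) ≤ edgeCount G t₀

  Balanced : Set
  Balanced = ∀ i j → i ≢ j → partCount part j t₀ + 2 ≤ partCount part i t₀ →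
             ∀ x → part x ≡ j → t₀ x ≡ true

  optimal⇒balanced : Optimal → Balanced
  optimal⇒balanced opt i j i≢j gap w pw≡j with t₀ w in t₀w
  ... | true  = refl
  ... | false = contradiction (opt T′ (count-exchange T₀ u w t₀u t₀w)) (<⇒≱ gain)
    where
    witness = count-witness (λ x → inPart i x ∧ t₀ x) (<-≤-trans z<s (≤-trans (m≤n+m 2 _) gap))
    u = proj₁ witness
    pu≡i : part u ≡ i
    pu≡i = does-≟⇒≡ (proj₁ (∧≡true (proj₂ witness)))
    t₀u : t₀ u ≡ true
    t₀u = proj₂ (∧≡true (proj₂ witness))
    T′ = exchange T₀ u w
    S = lookup (T₀ [ u ]≔ outside)
    ins-u = removal-insertion T₀ u w t₀u t₀w
    balance : edgeCount G t₀ + partCount part i S ≡ edgeCount G (lookup T′) + partCount part j S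
    balance = subst₂ (λ p q → edgeCount G t₀ + partCount part p S
                                ≡ edgeCount G (lookup T′) + partCount part q S)
                     pu≡i pw≡j (edgeCount-exchange M ins-u (exchange-insertion T₀ u w t₀u t₀w))
    gap′ : partCount part j S + 2 ≤ suc (partCount part i S)
    gap′ = subst₂ (λ p q → p + 2 ≤ q)
                  (partCount-insertion-other part ins-u (i≢j ∘ trans (sym pu≡i)))
                  (partCount-insertion-own part ins-u pu≡i) gap
    gain : edgeCount G t₀ < edgeCount G (lookup T′)
    gain = <-by-balance balance (≤-pred (≤-trans (≤-reflexive (+-comm 2 _)) gap′))

  surplus : Subset n → ℕ
  surplus T = count (λ x → not (t₀ x) ∧ lookup T x)

  record NonLosingExchange (T : Subset n) : Set where
    field
      u v       : Fin n
      u∈T       : lookup T u ≡ true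
      u∉T₀      : t₀ u ≡ false
      v∈T₀      : t₀ v ≡ true
      v∉T       : lookup T v ≡ false
      nonLosing : partCount part (part v) (lookup (T [ u ]≔ outside))
                    ≤ partCount part (part u) (lookup (T [ u ]≔ outside))

  nonLosingExchange-step : ∀ {T} (e : NonLosingExchange T) → let open NonLosingExchange e in
    edgeCount G (lookup T) ≤ edgeCount G (lookup (exchange T u v)) ×
    surplus T ≡ suc (surplus (exchange T u v))
  nonLosingExchange-step {T} e = ≤-by-balance (edgeCount-exchange M ins-u ins-v) nonLosing , (begin
    surplus T                         ≡⟨ count-insertion ins-u (not ∘ t₀) ⟩
    𝟙 (not (t₀ u)) + surplus S        ≡⟨ cong (λ b → 𝟙 (not b) + surplus S) u∉T₀ ⟩
    suc (surplus S)                   ≡⟨ cong (λ b → suc (𝟙 (not b) + surplus S)) (sym v∈T₀) ⟩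
    suc (𝟙 (not (t₀ v)) + surplus S)  ≡⟨ cong suc (sym (count-insertion ins-v (not ∘ t₀))) ⟩
    suc (surplus (exchange T u v))    ∎)
    where
    open ≡-Reasoning
    open NonLosingExchange e
    S = T [ u ]≔ outside
    ins-u = removal-insertion T u v u∈T v∉T
    ins-v = exchange-insertion T u v u∈T v∉T

  sameClass-exchange : ∀ {T u v} → lookup T u ≡ true → t₀ u ≡ false → t₀ v ≡ true →
    lookup T v ≡ false → part u ≡ part v → NonLosingExchange T
  sameClass-exchange {T} {u} u∈T u∉T₀ v∈T₀ v∉T pu≡pv =
    record { u∈T = u∈T ; u∉T₀ = u∉T₀ ; v∈T₀ = v∈T₀ ; v∉T = v∉T
           ; nonLosing = ≤-reflexive (cong (λ j → partCount part j (lookup (T [ u ]≔ outside)))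
                                           (sym pu≡pv)) }

  exchange-inside-class-of-u : ∀ {T u} → lookup T u ≡ true → t₀ u ≡ false →
    partCount part (part u) (lookup T) ≤ partCount part (part u) t₀ → NonLosingExchange T
  exchange-inside-class-of-u {T} {u} u∈T u∉T₀ cᵢT≤cᵢT₀
    with exchange-partner-within (inPart (part u)) (lookup T) t₀ cᵢT≤cᵢT₀
                                 (dec-true (part u ≟ᶠ part u) refl) u∈T u∉T₀
  ... | v , v∈Xᵢ , v∈T₀ , v∉T = sameClass-exchange u∈T u∉T₀ v∈T₀ v∉T (sym (does-≟⇒≡ v∈Xᵢ))

  exchange-inside-class-of-v : ∀ {T v} → t₀ v ≡ true → lookup T v ≡ false →
    partCount part (part v) t₀ ≤ partCount part (part v) (lookup T) → NonLosingExchange T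
  exchange-inside-class-of-v {T} {v} v∈T₀ v∉T cⱼT₀≤cⱼT
    with exchange-partner-within (inPart (part v)) t₀ (lookup T) cⱼT₀≤cⱼT
                                 (dec-true (part v ≟ᶠ part v) refl) v∈T₀ v∉T
  ... | u , u∈Xⱼ , u∈T , u∉T₀ = sameClass-exchange u∈T u∉T₀ v∈T₀ v∉T (does-≟⇒≡ u∈Xⱼ)

  crossClass-exchange : Balanced → ∀ {T u v} → lookup T u ≡ true → t₀ u ≡ false → t₀ v ≡ true →
    lookup T v ≡ false → part u ≢ part v →
    partCount part (part u) t₀ < partCount part (part u) (lookup T) →
    partCount part (part v) (lookup T) < partCount part (part v) t₀ → NonLosingExchange T
  crossClass-exchange bal {T} {u} {v} u∈T u∉T₀ v∈T₀ v∉T i≢j c₀ᵢ<cᵢ cⱼ<c₀ⱼ =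
    record { u∈T = u∈T ; u∉T₀ = u∉T₀ ; v∈T₀ = v∈T₀ ; v∉T = v∉T ; nonLosing = cⱼS≤cᵢS }
    where
    i = part u
    j = part v
    S = lookup (T [ u ]≔ outside)
    c₀ : Fin k → ℕ
    c₀ l = partCount part l t₀
    ins-u = removal-insertion T u v u∈T v∉T
    no-gap : ¬ (c₀ i + 2 ≤ c₀ j)
    no-gap gap = contradiction (trans (sym (bal j i (i≢j ∘ sym) gap u refl)) u∉T₀) λ ()
    c₀ⱼ≤1+c₀ᵢ : c₀ j ≤ suc (c₀ i)
    c₀ⱼ≤1+c₀ᵢ = m<1+n⇒m≤n (subst (c₀ j <_) (+-comm (c₀ i) 2) (≰⇒> no-gap))
    cⱼS<c₀ⱼ : partCount part j S < c₀ j
    cⱼS<c₀ⱼ = subst (_< c₀ j) (partCount-insertion-other part ins-u i≢j) cⱼ<c₀ⱼ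
    c₀ᵢ<1+cᵢS : c₀ i < suc (partCount part i S)
    c₀ᵢ<1+cᵢS = subst (c₀ i <_) (partCount-insertion-own part ins-u refl) c₀ᵢ<cᵢ
    cⱼS≤cᵢS : partCount part j S ≤ partCount part i S
    cⱼS≤cᵢS = ≤-trans (m<1+n⇒m≤n (<-≤-trans cⱼS<c₀ⱼ c₀ⱼ≤1+c₀ᵢ)) (m<1+n⇒m≤n c₀ᵢ<1+cᵢS)

  nonLosingExchange : Balanced → ∀ T → count (lookup T) ≡ count t₀ → 0 < surplus T →
    NonLosingExchange T
  nonLosingExchange bal T #T≡#T₀ 0<surplus
    with count-witness (λ x → not (t₀ x) ∧ lookup T x) 0<surplus
  ... | u , u∈T∖T₀ with not∧≡true u∈T∖T₀
  ... | u∉T₀ , u∈T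
    with exchange-partner-within (λ _ → true) (lookup T) t₀ (≤-reflexive #T≡#T₀) refl u∈T u∉T₀
  ... | v , _ , v∈T₀ , v∉T with partCount part (part u) (lookup T) ≤? partCount part (part u) t₀
  ...   | yes cᵢT≤cᵢT₀ = exchange-inside-class-of-u u∈T u∉T₀ cᵢT≤cᵢT₀
  ...   | no cᵢT≰cᵢT₀ with partCount part (part v) t₀ ≤? partCount part (part v) (lookup T)
  ...     | yes cⱼT₀≤cⱼT = exchange-inside-class-of-v v∈T₀ v∉T cⱼT₀≤cⱼT
  ...     | no cⱼT₀≰cⱼT with part u ≟ᶠ part v
  ...       | yes i≡j =
    contradiction (subst (λ l → partCount part l (lookup T) < partCount part l t₀) (sym i≡j) (≰⇒> cⱼT₀≰cⱼT))
                  (<-asym (≰⇒> cᵢT≰cᵢT₀))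
  ...       | no i≢j = crossClass-exchange bal u∈T u∉T₀ v∈T₀ v∉T i≢j (≰⇒> cᵢT≰cᵢT₀) (≰⇒> cⱼT₀≰cⱼT)

  balanced⇒optimal : Balanced → Optimal
  balanced⇒optimal bal T = descend (surplus T) T refl
    where
    descend : ∀ m T → surplus T ≡ m → count (lookup T) ≡ count t₀ →
              edgeCount G (lookup T) ≤ edgeCount G t₀
    descend zero T T⊆T₀ _ =
      edgeCount-mono G λ x → not∧≡false⇒≤ (count≡0⇒≡false (λ y → not (t₀ y) ∧ lookup T y) T⊆T₀ x)
    descend (suc m) T surplus≡1+m #T≡#T₀
      with nonLosingExchange bal T #T≡#T₀ (subst (0 <_) (sym surplus≡1+m) z<s)
    ... | e with nonLosingExchange-step e
    ...   | T≤T′ , surplus≡1+surplus′ = ≤-trans T≤T′ (descend m (exchange T u v)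
              (suc-injective (trans (sym surplus≡1+surplus′) surplus≡1+m))
              (trans (count-exchange T u v u∈T v∉T) #T≡#T₀))
      where open NonLosingExchange e

module _ {a b p} {A : Set a} {B : Set b} {P : Pred (A × B) p} (P? : Decidable P) where

  length-filter-tabulate : ∀ {m} (f : Fin m → A × B) →
    length (filter P? (List.tabulate f)) ≡ count (λ i → does (P? (f i)))
  length-filter-tabulate {zero}  f = refl
  length-filter-tabulate {suc m} f with does (P? (f zero))
  ... | true  = cong suc (length-filter-tabulate (f ∘ suc))
  ... | false = length-filter-tabulate (f ∘ suc)

  length-filter-cartesianProduct : ∀ {m n} (g : Fin m → A) (h : Fin n → B) →
    length (filter P? (cartesianProduct (List.tabulate g) (List.tabulate h)))
      ≡ sum λ i → count λ j → does (P? (g i , h j))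
  length-filter-cartesianProduct {zero}  g h = refl
  length-filter-cartesianProduct {suc m} g h = begin
    length (filter P? (first ++ rest))
      ≡⟨ cong length (filter-++ P? first rest) ⟩
    length (filter P? first ++ filter P? rest)
      ≡⟨ length-++ (filter P? first) ⟩
    length (filter P? first) + length (filter P? rest)
      ≡⟨ cong₂ _+_ first-row (length-filter-cartesianProduct (g ∘ suc) h) ⟩
    (sum λ i → count λ j → does (P? (g i , h j)))
      ∎
    where
    open ≡-Reasoning
    first = map (g zero ,_) (List.tabulate h)
    rest  = cartesianProduct (List.tabulate (g ∘ suc)) (List.tabulate h)
    first-row : length (filter P? first) ≡ count (λ j → does (P? (g zero , h j)))
    first-row = trans (cong (length ∘ filter P?) (map-tabulate h (g zero ,_)))
                      (length-filter-tabulate (λ j → g zero , h j))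

∣∣≡count : ∀ {n} (T : Subset n) → ∣ T ∣ ≡ count (lookup T)
∣∣≡count []          = refl
∣∣≡count (true  ∷ T) = cong suc (∣∣≡count T)
∣∣≡count (false ∷ T) = ∣∣≡count T

does-∈? : ∀ {n} (x : Fin n) (T : Subset n) → does (x ∈? T) ≡ lookup T x
does-∈? zero    (true  ∷ T) = refl
does-∈? zero    (false ∷ T) = refl
does-∈? (suc x) (_ ∷ T)     = does-∈? x T

does-≟true : ∀ b → does (b 𝔹.≟ true) ≡ b
does-≟true true  = refl
does-≟true false = refl

edgesIn≡edgeCount : ∀ {n} (G : SimpleGraph n) (T : Subset n) → edgesIn G T ≡ edgeCount G (lookup T)
edgesIn≡edgeCount {n} G T = trans (length-filter-cartesianProduct _ (id {A = Fin n}) (id {A = Fin n}))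
  (sum-cong-≗ λ x → sum-cong-≗ λ y → cong 𝟙
    (cong₂ _∧_ (cong₂ _∧_ (cong (x <ᵇ y ∧_) (does-∈? x T)) (does-∈? y T)) (does-≟true (adj G x y))))

module _ {n k} (part : Fin n → Fin k) where

  lookup-partSet : ∀ j x → lookup (partSet part j) x ≡ does (part x ≟ᶠ j)
  lookup-partSet j x = trans (lookup∘tabulate _ x) (isYes≗does (part x ≟ᶠ j))

  ∣partSet∩∣≡partCount : ∀ j (T : Subset n) →
    ∣ partSet part j ∩ T ∣ ≡ partCount part j (lookup T)
  ∣partSet∩∣≡partCount j T = trans (∣∣≡count (partSet part j ∩ T)) (sum-cong-≗ λ x → cong 𝟙
    (trans (lookup-zipWith _∧_ x (partSet part j) T) (cong (_∧ lookup T x) (lookup-partSet j x))))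

  partSet⊆⇔ : ∀ j (T : Subset n) → partSet part j ⊆ T ⇔ (∀ x → part x ≡ j → lookup T x ≡ true)
  partSet⊆⇔ j T = mk⇔
    (λ Xⱼ⊆T x px≡j → []=⇒lookup (Xⱼ⊆T (lookup⇒[]= x (partSet part j)
       (trans (lookup-partSet j x) (dec-true (part x ≟ᶠ j) px≡j)))))
    (λ Xⱼ⊆T {x} x∈Xⱼ →
       lookup⇒[]= x T (Xⱼ⊆T x (does-≟⇒≡ (trans (sym (lookup-partSet j x)) ([]=⇒lookup x∈Xⱼ)))))

module _ {n k} {G : SimpleGraph n} {part : Fin n → Fin k} (M : IsCompleteMultipartite G k part)
         (T₀ : Subset n) where

  open Equivalence

  optimalSubsets⇔Optimal : (∀ (T : Subset n) → ∣ T ∣ ≡ ∣ T₀ ∣ → edgesIn G T ≤ edgesIn G T₀) ⇔ Optimal M T₀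
  optimalSubsets⇔Optimal = mk⇔
    (λ opt T → to (edges T) ∘ opt T ∘ from (sizes T))
    (λ opt T → from (edges T) ∘ opt T ∘ to (sizes T))
    where
    sizes : ∀ T → (∣ T ∣ ≡ ∣ T₀ ∣) ⇔ (count (lookup T) ≡ count (lookup T₀))
    sizes T rewrite ∣∣≡count T | ∣∣≡count T₀ = mk⇔ id id
    edges : ∀ T → (edgesIn G T ≤ edgesIn G T₀) ⇔ (edgeCount G (lookup T) ≤ edgeCount G (lookup T₀))
    edges T rewrite edgesIn≡edgeCount G T | edgesIn≡edgeCount G T₀ = mk⇔ id id

  partSetCondition⇔Balanced :
    (∀ (i j : Fin k) → i ≢ j → ∣ partSet part j ∩ T₀ ∣ + 2 ≤ ∣ partSet part i ∩ T₀ ∣ → partSet part j ⊆ T₀)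
      ⇔ Balanced M T₀
  partSetCondition⇔Balanced = mk⇔
    (λ cond i j i≢j → to (partSet⊆⇔ part j T₀) ∘ cond i j i≢j ∘ from (gaps i j))
    (λ bal i j i≢j → from (partSet⊆⇔ part j T₀) ∘ bal i j i≢j ∘ to (gaps i j))
    where
    gaps : ∀ i j → (∣ partSet part j ∩ T₀ ∣ + 2 ≤ ∣ partSet part i ∩ T₀ ∣)
                   ⇔ (partCount part j (lookup T₀) + 2 ≤ partCount part i (lookup T₀))
    gaps i j rewrite ∣partSet∩∣≡partCount part i T₀ | ∣partSet∩∣≡partCount part j T₀ = mk⇔ id id

lemma5p1 : (n k : ℕ) → 2 ≤ k → (G : SimpleGraph n) → (part : Fin n → Fin k) →
    IsCompleteMultipartite G k part →
    (b : ℕ) → 1 ≤ b → b ≤ n → (T₀ : Subset n) → ∣ T₀ ∣ ≡ b →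
    ((∀ (T : Subset n) → ∣ T ∣ ≡ b → edgesIn G T ≤ edgesIn G T₀)
    ⇔ (∀ (i j : Fin k) → i ≢ j →
    ∣ partSet part j ∩ T₀ ∣ + 2 ≤ ∣ partSet part i ∩ T₀ ∣ →
    partSet part j ⊆ T₀))
lemma5p1 n k _ G part M _ _ _ T₀ refl = mk⇔
  (from (partSetCondition⇔Balanced M T₀) ∘ optimal⇒balanced M T₀ ∘ to (optimalSubsets⇔Optimal M T₀))
  (from (optimalSubsets⇔Optimal M T₀) ∘ balanced⇒optimal M T₀ ∘ to (partSetCondition⇔Balanced M T₀))
  where open Equivalence
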